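{- Let $\lambda$ be a partition of $n$. Then the number of states of $\mathcal{L}(\lambda)$ is at most $n+1$, and, if $\lambda$ is nonempty, the number of states of $\mathcal{D}(\lambda)$ is at most $n$. Moreover, the number of states of both $\mathcal{L}(\lambda)$ and $\mathcal{D}(\lambda)$ is bounded below by $\Omega(\sqrt{n})$ (i.e. there is a constant $C>0$ such that for every $n\ge1$ and every nonempty $\lambda\vdash n$ both numbers are at least $C\sqrt n$).
   Context: For a partition $\mu=(\mu_1,\dots,\mu_s)$ and nonnegative integers $i,j$, $\mu[i,j]$ is $(\mu_{i+1}-j,\mu_{i+2}-j,\dots)$ with nonpositive entries removed, if $i<s$ and $j<\mu_{i+1}$; otherwise $\mu[i,j]=()$. LCTR $\mathcal{L}(\lambda)$: positions are partitions, starting at $\lambda$; from a nonempty $\mu$ one moves to $\mu[1,0]$ or $\mu[0,1]$; $()$ is terminal. Downright $\mathcal{D}(\lambda)$ (nonempty $\lambda$): positions are nonempty partitions, starting at $\lambda$; from $\mu=(\mu_1,\dots,\mu_s)$ one may move to $\mu[1,0]$ if $s>1$ and to $\mu[0,1]$ if $\mu_1>1$. The number of states (state-space complexity) of a game with initial position $p$ is the number of pairwise distinct positions reachable from $p$ by zero or more moves, where two positions are considered distinct if their game trees are not isomorphic. -}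

module Defs where

open import Data.Nat using (ℕ; zero; suc; _∸_; _<_; _≥_; _<?_)
open import Data.List using (List; []; _∷_; _++_; drop; map; filter; length)
open import Data.Nat.ListAction using (sum)
open import Data.List.Relation.Unary.All using (All)
open import Data.List.Relation.Unary.Any using (Any)
open import Data.List.Relation.Unary.AllPairs using (AllPairs)
open import Data.List.Relation.Unary.Linked using (Linked)
open import Data.List.Relation.Binary.Permutation.Homogeneous using (Permutation)
open import Data.List.Membership.Propositional using (_∈_)
open import Data.Product using (Σ; _×_)
open import Relation.Binary.PropositionalEquality using (_≡_)
open import Relation.Binary.Construct.Closure.ReflexiveTransitive using (Star)
open import Relation.Nullary using (¬_; yes; no)

IsPartition : List ℕ → Set
IsPartition μ = All (0 <_) μ × Linked _≥_ μ

_⊢_ : List ℕ → ℕ → Set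
μ ⊢ n = IsPartition μ × sum μ ≡ n

-- μ[i,j]: if i < s and j < μ_{i+1}, the list (μ_{i+1}-j, μ_{i+2}-j, …)
-- with nonpositive entries removed; otherwise ().

shift : ℕ → ℕ → List ℕ → List ℕ
shift i j μ with drop i μ
... | [] = []
... | m ∷ rest with j <? m
...   | yes _ = filter (0 <?_) (map (_∸ j) (m ∷ rest))
...   | no  _ = []

-- Games given by an option function (moves from a position, as a list;
-- each move is one edge of the game tree).

Options : Set
Options = List ℕ → List (List ℕ)

lctr : Options
lctr [] = []
lctr μ@(_ ∷ _) = shift 1 0 μ ∷ shift 0 1 μ ∷ []

downright : Options
downright [] = []
downright μ@(m ∷ rest) = left ++ down
  where
  left : List (List ℕ)
  left with 1 <? length μ
  ... | yes _ = shift 1 0 μ ∷ []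
  ... | no  _ = []
  down : List (List ℕ)
  down with 1 <? m
  ... | yes _ = shift 0 1 μ ∷ []
  ... | no  _ = []

Move : Options → List ℕ → List ℕ → Set
Move opts p q = q ∈ opts p

Reach : Options → List ℕ → List ℕ → Set
Reach opts = Star (Move opts)

-- Isomorphism of the game trees rooted at two positions: the game tree of
-- p is the rooted tree whose children are the game trees of the options of
-- p; two rooted (unordered) trees are isomorphic iff the lists of children
-- can be matched by a permutation with pairwise isomorphic subtrees.
data GameIso (opts : Options) : List ℕ → List ℕ → Set where
  iso : ∀ {p q} → Permutation (GameIso opts) (opts p) (opts q) → GameIso opts p q

-- "The number of states of the game with initial position p is k":
-- there are k reachable positions with pairwise non-isomorphic game trees,
-- and every reachable position has game tree isomorphic to one of them.
NumStates : Options → List ℕ → ℕ → Set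
NumStates opts p k =
  Σ (List (List ℕ)) λ xs →
      length xs ≡ k
    × All (Reach opts p) xs
    × AllPairs (λ x y → ¬ GameIso opts x y) xs
    × (∀ q → Reach opts p q → Any (GameIso opts q) xs)

-- Every position reachable from a partition λ in either game is a subdiagram λ[i,j], obtained by
-- deleting the first i rows and j columns of the Young diagram; it is either empty or determined
-- by the cell (i,j), so there are at most n + 1 of them, and Downright never reaches the empty
-- position. Both games are finite with at most two options per position, so isomorphism of game
-- trees is decidable and deduplicating the reachable positions counts the states.
-- Conversely, isomorphic games have plays of the same lengths while the plays of a proper
-- follower are strictly shorter, so no position is isomorphic to a proper follower. The
-- positions λ[0,j] (j < λ₁) and λ[i,0] (i < ℓ(λ)) thus give λ₁ and ℓ(λ) pairwise non-isomorphic
-- states, whence n ≤ λ₁ ℓ(λ) ≤ k².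

module Submission where

open import Defs
open import Data.Nat
open import Data.Nat.Properties
open import Data.Nat.ListAction using (sum)
open import Data.Fin using (Fin; toℕ)
open import Data.Fin.Properties using (pigeonhole; toℕ<n)
open import Data.List using (List; []; _∷_; _++_; drop; map; filter; length; applyUpTo; deduplicate)
open import Data.List.Properties
  using ( filter-accept; filter-reject; filter-all; filter-none; map-id; map-∘; map-cong
        ; drop-drop; length-drop; length-++; length-applyUpTo; length-deduplicate )
open import Data.List.Relation.Unary.All as All using (All; []; _∷_)
import Data.List.Relation.Unary.All.Properties as All
open import Data.List.Relation.Unary.AllPairs as AllPairs using (AllPairs; []; _∷_)
import Data.List.Relation.Unary.AllPairs.Properties as AllPairs
open import Data.List.Relation.Unary.Linked using (Linked)
open import Data.List.Relation.Unary.Linked.Properties using (Linked⇒AllPairs)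
open import Data.List.Relation.Unary.Any as Any using (Any; here; there)
open import Data.List.Relation.Unary.Any.Properties using (++⁺ˡ; ++⁺ʳ)
open import Data.List.Relation.Unary.Unique.DecSetoid.Properties using (deduplicate-!)
open import Data.List.Relation.Binary.Pointwise.Base using (Pointwise; []; _∷_)
open import Data.List.Relation.Binary.Permutation.Homogeneous as Perm using (Permutation)
import Data.List.Relation.Binary.Permutation.Setoid.Properties as Permutation
open import Data.List.Membership.Propositional using (_∈_; find)
open import Data.List.Membership.Propositional.Properties using (∈-applyUpTo⁺)
import Data.List.Membership.Setoid.Properties as Membership
open import Data.Product using (Σ; ∃; ∃₂; _×_; _,_)
open import Data.Sum using (_⊎_; inj₁; inj₂; map₂; [_,_]′)
open import Data.Unit using (⊤)
open import Function using (_∘_; flip)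
open import Level using (0ℓ)
open import Relation.Binary.Bundles using (Setoid; DecSetoid)
open import Relation.Binary.Definitions using (Reflexive; Symmetric; Transitive; Decidable)
open import Relation.Binary.Construct.Closure.ReflexiveTransitive using (ε; _◅_; _◅◅_)
open import Relation.Binary.PropositionalEquality
open import Relation.Nullary using (¬_; Dec; yes; no; contradiction)
open import Relation.Nullary.Decidable using (map′; _×-dec_; _⊎-dec_)

Positive : List ℕ → Set
Positive = All (0 <_)

Descending : List ℕ → Set
Descending = AllPairs _≥_

partition-descending : ∀ {μ} → Linked _≥_ μ → Descending μ
partition-descending = Linked⇒AllPairs (flip ≤-trans)

dropColumns : ℕ → List ℕ → List ℕ
dropColumns j μ = filter (0 <?_) (map (_∸ j) μ)

dropColumns-accept : ∀ j x xs → 0 < x ∸ j → dropColumns j (x ∷ xs) ≡ x ∸ j ∷ dropColumns j xs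
dropColumns-accept _ _ _ = filter-accept (0 <?_)

dropColumns-reject : ∀ j x xs → ¬ 0 < x ∸ j → dropColumns j (x ∷ xs) ≡ dropColumns j xs
dropColumns-reject _ _ _ = filter-reject (0 <?_)

dropColumns-zero : ∀ {μ} → Positive μ → dropColumns 0 μ ≡ μ
dropColumns-zero {μ} pos = trans (cong (filter (0 <?_)) (map-id μ)) (filter-all (0 <?_) pos)

dropColumns-empty : ∀ {j μ} → All (_≤ j) μ → dropColumns j μ ≡ []
dropColumns-empty = filter-none (0 <?_) ∘ All.map⁺ ∘ All.map (λ x≤j → <-irrefl (sym (m≤n⇒m∸n≡0 x≤j)))

dropColumns-≥-head : ∀ {j m r} → Descending (m ∷ r) → m ≤ j → dropColumns j (m ∷ r) ≡ []
dropColumns-≥-head (m≥r ∷ _) m≤j = dropColumns-empty (m≤j ∷ All.map (flip ≤-trans m≤j) m≥r)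

dropColumns-positive : ∀ j μ → Positive (dropColumns j μ)
dropColumns-positive j μ = All.all-filter (0 <?_) (map (_∸ j) μ)

dropColumns-descending : ∀ j {μ} → Descending μ → Descending (dropColumns j μ)
dropColumns-descending j = AllPairs.filter⁺ (0 <?_) ∘ AllPairs.map⁺ ∘ AllPairs.map (∸-monoˡ-≤ j)

dropColumns-∷-cong : ∀ j x xs ys → dropColumns j xs ≡ dropColumns j ys →
                     dropColumns j (x ∷ xs) ≡ dropColumns j (x ∷ ys)
dropColumns-∷-cong j x xs ys eq with 0 <? x ∸ j
... | yes x>j =
  trans (dropColumns-accept j x xs x>j) (trans (cong (x ∸ j ∷_) eq) (sym (dropColumns-accept j x ys x>j)))
... | no x≯j = trans (dropColumns-reject j x xs x≯j) (trans eq (sym (dropColumns-reject j x ys x≯j)))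

dropColumns-filter : ∀ a xs → dropColumns a (filter (0 <?_) xs) ≡ dropColumns a xs
dropColumns-filter a [] = refl
dropColumns-filter a (x ∷ xs) with 0 <? x
... | yes x>0 = trans (cong (dropColumns a) (filter-accept (0 <?_) x>0))
                      (dropColumns-∷-cong a x (filter (0 <?_) xs) xs (dropColumns-filter a xs))
... | no x≯0 = begin
  dropColumns a (filter (0 <?_) (x ∷ xs)) ≡⟨ cong (dropColumns a) (filter-reject (0 <?_) x≯0) ⟩
  dropColumns a (filter (0 <?_) xs)       ≡⟨ dropColumns-filter a xs ⟩
  dropColumns a xs                        ≡⟨ dropColumns-reject a x xs (x≯0 ∘ flip <-≤-trans (m∸n≤m x a)) ⟨
  dropColumns a (x ∷ xs)                  ∎
  where open ≡-Reasoning

dropColumns-+ : ∀ a b μ → dropColumns a (dropColumns b μ) ≡ dropColumns (b + a) μ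
dropColumns-+ a b μ = begin
  dropColumns a (dropColumns b μ)                ≡⟨ dropColumns-filter a (map (_∸ b) μ) ⟩
  filter (0 <?_) (map (_∸ a) (map (_∸ b) μ))     ≡⟨ cong (filter (0 <?_)) (sym (map-∘ μ)) ⟩
  filter (0 <?_) (map ((_∸ a) ∘ (_∸ b)) μ)       ≡⟨ cong (filter (0 <?_)) (map-cong (λ x → ∸-+-assoc x b a) μ) ⟩
  dropColumns (b + a) μ                          ∎
  where open ≡-Reasoning

drop-dropColumns : ∀ j {μ} → Descending μ → drop 1 (dropColumns j μ) ≡ dropColumns j (drop 1 μ)
drop-dropColumns j {[]} _ = refl
drop-dropColumns j {m ∷ r} desc@(m≥r ∷ _) with j <? m
... | yes j<m = cong (drop 1) (dropColumns-accept j m r (m<n⇒0<n∸m j<m))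
... | no j≮m = begin
  drop 1 (dropColumns j (m ∷ r)) ≡⟨ cong (drop 1) (dropColumns-≥-head desc (≮⇒≥ j≮m)) ⟩
  []                             ≡⟨ dropColumns-empty (All.map (flip ≤-trans (≮⇒≥ j≮m)) m≥r) ⟨
  dropColumns j r                ∎
  where open ≡-Reasoning

shift-descending : ∀ i j {μ} → Descending μ → shift i j μ ≡ dropColumns j (drop i μ)
shift-descending i j {μ} desc with drop i μ | AllPairs.drop⁺ i desc
... | [] | _ = refl
... | m ∷ rest | desc′ with j <? m
...   | yes _ = refl
...   | no j≮m = sym (dropColumns-≥-head desc′ (≮⇒≥ j≮m))

shift-1-0 : ∀ {μ} → Positive μ → Descending μ → shift 1 0 μ ≡ drop 1 μ
shift-1-0 pos desc = trans (shift-descending 1 0 desc) (dropColumns-zero (All.drop⁺ 1 pos))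

shift-positive : ∀ i j μ → Positive (shift i j μ)
shift-positive i j μ with drop i μ
... | [] = []
... | m ∷ rest with j <? m
...   | yes _ = dropColumns-positive j (m ∷ rest)
...   | no _ = []

size : List ℕ → ℕ
size [] = 0
size (x ∷ xs) = suc (x + size xs)

size-dropColumns-≤ : ∀ j μ → size (dropColumns j μ) ≤ size μ
size-dropColumns-≤ j [] = z≤n
size-dropColumns-≤ j (x ∷ xs) with 0 <? x ∸ j
... | yes x>j rewrite dropColumns-accept j x xs x>j =
  s≤s (+-mono-≤ (m∸n≤m x j) (size-dropColumns-≤ j xs))
... | no x≯j rewrite dropColumns-reject j x xs x≯j =
  m≤n⇒m≤1+n (≤-trans (size-dropColumns-≤ j xs) (m≤n+m _ x))

size-shift-≤ : ∀ i j μ → size (shift i j μ) ≤ size (drop i μ)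
size-shift-≤ i j μ with drop i μ
... | [] = z≤n
... | m ∷ rest with j <? m
...   | yes _ = size-dropColumns-≤ j (m ∷ rest)
...   | no _ = z≤n

size-shift-< : ∀ m r {q} → q ≡ shift 1 0 (m ∷ r) ⊎ q ≡ shift 0 1 (m ∷ r) → size q < size (m ∷ r)
size-shift-< m r (inj₁ refl) = s≤s (≤-trans (size-shift-≤ 1 0 (m ∷ r)) (m≤n+m _ m))
size-shift-< zero _ (inj₂ refl) = s≤s z≤n
size-shift-< (suc zero) _ (inj₂ refl) = s≤s z≤n
size-shift-< (suc (suc k)) r (inj₂ refl) = s≤s (s≤s (s≤s (+-monoʳ-≤ k (size-dropColumns-≤ 1 r))))

cells : List ℕ → List (List ℕ)
cells [] = []
cells μ@(m ∷ r) = applyUpTo (λ j → dropColumns j μ) m ++ cells r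

length-cells : ∀ μ → length (cells μ) ≡ sum μ
length-cells [] = refl
length-cells μ@(m ∷ r) = begin
  length (applyUpTo (λ j → dropColumns j μ) m ++ cells r)  ≡⟨ length-++ (applyUpTo _ m) ⟩
  length (applyUpTo (λ j → dropColumns j μ) m) + length (cells r)
    ≡⟨ cong₂ _+_ (length-applyUpTo _ m) (length-cells r) ⟩
  m + sum r                                                  ∎
  where open ≡-Reasoning

subdiagram-cell : ∀ i j {μ} → Descending μ →
                  dropColumns j (drop i μ) ≡ [] ⊎ dropColumns j (drop i μ) ∈ cells μ
subdiagram-cell zero j {[]} _ = inj₁ refl
subdiagram-cell (suc i) j {[]} _ = inj₁ refl
subdiagram-cell zero j {m ∷ r} desc with j <? m
... | yes j<m = inj₂ (++⁺ˡ (∈-applyUpTo⁺ (λ j → dropColumns j (m ∷ r)) j<m))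
... | no j≮m = inj₁ (dropColumns-≥-head desc (≮⇒≥ j≮m))
subdiagram-cell (suc i) j {m ∷ r} (_ ∷ desc) = map₂ (++⁺ʳ _) (subdiagram-cell i j desc)

sum-≤-length*head : ∀ {m r} → Descending (m ∷ r) → sum (m ∷ r) ≤ length (m ∷ r) * m
sum-≤-length*head {m} {r} (m≥r ∷ _) = +-monoʳ-≤ m (bound m≥r)
  where
  bound : ∀ {xs} → All (_≤ m) xs → sum xs ≤ length xs * m
  bound [] = z≤n
  bound (x≤m ∷ xs≤m) = +-mono-≤ x≤m (bound xs≤m)

module ShortPermutation {a ℓ} (S : Setoid a ℓ) where

  open Setoid S using (_≈_) renaming (refl to ≈-refl; sym to ≈-sym)
  open import Data.List.Relation.Binary.Permutation.Setoid S using (_↭_; ↭-refl; ↭-trans; prep; swap)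
  open import Data.List.Relation.Binary.Permutation.Setoid.Properties S

  private
    ↭-singleton : ∀ {x y} → x ∷ [] ↭ y ∷ [] → x ≈ y
    ↭-singleton π with ∈-resp-↭ π (here ≈-refl)
    ... | here x≈y = x≈y

    ↭-pair : ∀ {x y z w} → x ∷ y ∷ [] ↭ z ∷ w ∷ [] → (x ≈ z × y ≈ w) ⊎ (x ≈ w × y ≈ z)
    ↭-pair π with ∈-resp-↭ π (here ≈-refl)
    ... | here x≈z = inj₁ (x≈z , ↭-singleton (drop-∷ (↭-trans π (prep (≈-sym x≈z) ↭-refl))))
    ... | there (here x≈w) =
      inj₂ (x≈w , ↭-singleton (drop-∷ (↭-trans π (swap ≈-refl (≈-sym x≈w) ↭-refl))))

  ↭-dec₂ : ∀ xs ys → length xs ≤ 2 → length ys ≤ 2 →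
           (∀ {x} → x ∈ xs → ∀ y → Dec (x ≈ y)) → Dec (xs ↭ ys)
  ↭-dec₂ [] [] _ _ _ = yes ↭-refl
  ↭-dec₂ [] (_ ∷ _) _ _ _ = no (λ π → contradiction (xs↭ys⇒|xs|≡|ys| π) λ ())
  ↭-dec₂ (_ ∷ _) [] _ _ _ = no (λ π → contradiction (xs↭ys⇒|xs|≡|ys| π) λ ())
  ↭-dec₂ (_ ∷ []) (_ ∷ _ ∷ _) _ _ _ = no (λ π → contradiction (xs↭ys⇒|xs|≡|ys| π) λ ())
  ↭-dec₂ (_ ∷ _ ∷ _) (_ ∷ []) _ _ _ = no (λ π → contradiction (xs↭ys⇒|xs|≡|ys| π) λ ())
  ↭-dec₂ (x ∷ []) (z ∷ []) _ _ _≟_ = map′ (λ x≈z → prep x≈z ↭-refl) ↭-singleton (here refl ≟ z)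
  ↭-dec₂ (x ∷ y ∷ []) (z ∷ w ∷ []) _ _ _≟_ =
    map′ (λ { (inj₁ (x≈z , y≈w)) → prep x≈z (prep y≈w ↭-refl)
            ; (inj₂ (x≈w , y≈z)) → swap x≈w y≈z ↭-refl })
         ↭-pair
         (  ((here refl ≟ z) ×-dec (there (here refl) ≟ w))
         ⊎-dec ((here refl ≟ w) ×-dec (there (here refl) ≟ z)))
  ↭-dec₂ (_ ∷ _ ∷ []) (_ ∷ _ ∷ _ ∷ _) _ (s≤s (s≤s ())) _
  ↭-dec₂ (_ ∷ _ ∷ _ ∷ _) _ (s≤s (s≤s ())) _ _

module _ {opts : Options} where

  mutual
    ≅-sym : Symmetric (GameIso opts)
    ≅-sym (iso π) = iso (↭-sym π)

    private
      ↭-sym : Symmetric (Permutation (GameIso opts))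
      ↭-sym (Perm.refl ps) = Perm.refl (≋-sym ps)
      ↭-sym (Perm.prep e π) = Perm.prep (≅-sym e) (↭-sym π)
      ↭-sym (Perm.swap e f π) = Perm.swap (≅-sym f) (≅-sym e) (↭-sym π)
      ↭-sym (Perm.trans π ρ) = Perm.trans (↭-sym ρ) (↭-sym π)

      ≋-sym : Symmetric (Pointwise (GameIso opts))
      ≋-sym [] = []
      ≋-sym (e ∷ es) = ≅-sym e ∷ ≋-sym es

  ≅-trans : Transitive (GameIso opts)
  ≅-trans (iso π) (iso ρ) = iso (Perm.trans π ρ)

module Chains (opts : Options) where

  Chain : (ℕ → List ℕ) → ℕ → Set
  Chain g N = ∀ i → suc i < N → Move opts (g i) (g (suc i))

  chain-reach : ∀ {g N i j} → Chain g N → i ≤ j → j < N → Reach opts (g i) (g j)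
  chain-reach {j = zero} chain z≤n _ = ε
  chain-reach {j = suc j} chain i≤1+j 1+j<N with m≤n⇒m<n∨m≡n i≤1+j
  ... | inj₁ (s≤s i≤j) = chain-reach chain i≤j (<-trans (n<1+n j) 1+j<N) ◅◅ (chain j 1+j<N ◅ ε)
  ... | inj₂ refl = ε

private
  diagonal : ∀ {R : List ℕ → List ℕ → Set} {xs} → (∀ {x} → x ∈ xs → R x x) → Pointwise R xs xs
  diagonal {xs = []} _ = []
  diagonal {xs = x ∷ xs} r = r (here refl) ∷ diagonal (r ∘ there)

module RankedGame (opts : Options) (rank : List ℕ → ℕ)
  (rank-< : ∀ {p q} → Move opts p q → rank q < rank p)
  (branching-≤2 : ∀ p → length (opts p) ≤ 2) where

  open Chains opts

  ≅-refl : Reflexive (GameIso opts)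
  ≅-refl {p} = below (n<1+n (rank p))
    where
    below : ∀ {f p} → rank p < f → GameIso opts p p
    below {suc f} (s≤s r≤f) = iso (Perm.refl (diagonal λ m → below (<-≤-trans (rank-< m) r≤f)))

  ≅-setoid : Setoid 0ℓ 0ℓ
  ≅-setoid = record
    { Carrier = List ℕ
    ; _≈_ = GameIso opts
    ; isEquivalence = record { refl = ≅-refl ; sym = ≅-sym ; trans = ≅-trans }
    }

  open ShortPermutation ≅-setoid using (↭-dec₂)

  _≅?_ : Decidable (GameIso opts)
  _≅?_ p = below (n<1+n (rank p))
    where
    below : ∀ {f p} → rank p < f → ∀ q → Dec (GameIso opts p q)
    below {suc f} {p} (s≤s r≤f) q =
      map′ iso (λ { (iso π) → π })
        (↭-dec₂ (opts p) (opts q) (branching-≤2 p) (branching-≤2 q)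
                (λ m → below (<-≤-trans (rank-< m) r≤f)))

  ≅-decSetoid : DecSetoid 0ℓ 0ℓ
  ≅-decSetoid = record
    { Carrier = List ℕ
    ; _≈_ = GameIso opts
    ; isDecEquivalence = record { isEquivalence = Setoid.isEquivalence ≅-setoid ; _≟_ = _≅?_ }
    }

  numStates-≤ : ∀ {p} L → All (Reach opts p) L → (∀ {q} → Reach opts p q → q ∈ L) →
                ∃ λ k → NumStates opts p k × k ≤ length L
  numStates-≤ L reachable complete =
    length (deduplicate _≅?_ L) ,
    (deduplicate _≅?_ L , refl , All.deduplicate⁺ _≅?_ reachable , deduplicate-! ≅-decSetoid L , covered) ,
    length-deduplicate _≅?_ L
    where
    covered : ∀ q → Reach opts _ q → Any (GameIso opts q) (deduplicate _≅?_ L)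
    covered q r = Membership.∈-deduplicate⁺ ≅-setoid _≅?_ (λ z≅y x≅y → ≅-trans x≅y (≅-sym z≅y))
                    (Any.map (λ { refl → ≅-refl }) (complete r))

  HasPlay : ℕ → List ℕ → Set
  HasPlay zero _ = ⊤
  HasPlay (suc d) p = Any (HasPlay d) (opts p)

  hasPlay-resp-≅ : ∀ d {p q} → GameIso opts p q → HasPlay d p → HasPlay d q
  hasPlay-resp-≅ zero _ _ = _
  hasPlay-resp-≅ (suc d) (iso π) = Permutation.Any-resp-↭ ≅-setoid (hasPlay-resp-≅ d) π

  hasPlay-pred : ∀ d {p} → HasPlay (suc d) p → HasPlay d p
  hasPlay-pred zero _ = _
  hasPlay-pred (suc d) = Any.map (hasPlay-pred d)

  hasPlay-move : ∀ {d p q} → Move opts p q → HasPlay d q → HasPlay (suc d) p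
  hasPlay-move m h = Any.map (λ { refl → h }) m

  hasPlay-reach : ∀ {d p q} → Reach opts p q → HasPlay d q → HasPlay d p
  hasPlay-reach ε h = h
  hasPlay-reach (m ◅ r) h = hasPlay-pred _ (hasPlay-move m (hasPlay-reach r h))

  hasPlay-≤-rank : ∀ d {p} → HasPlay d p → d ≤ rank p
  hasPlay-≤-rank zero _ = z≤n
  hasPlay-≤-rank (suc d) h with _ , m , h′ ← find h =
    <-≤-trans (s≤s (hasPlay-≤-rank d h′)) (rank-< m)

  -- p ≅ q would give q plays of every length, while its plays are bounded by its rank.
  descendant-≇ : ∀ {p p′ q} → Move opts p p′ → Reach opts p′ q → ¬ GameIso opts p q
  descendant-≇ {q = q} m r p≅q = <-irrefl refl (hasPlay-≤-rank (suc (rank q)) (plays (suc (rank q))))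
    where
    plays : ∀ d → HasPlay d q
    plays zero = _
    plays (suc d) = hasPlay-resp-≅ (suc d) p≅q (hasPlay-move m (hasPlay-reach r (plays d)))

  chain-length-≤ : ∀ {p g N k} → Chain g N → Reach opts p (g 0) → NumStates opts p k → N ≤ k
  chain-length-≤ {p} {g} {N} chain reach₀ (xs , refl , _ , _ , cover) = ≮⇒≥ λ k<N →
    let i , j , i<j , same = pigeonhole k<N position in
    descendant-≇ (chain (toℕ i) (≤-<-trans i<j (toℕ<n j))) (chain-reach chain i<j (toℕ<n j))
      (Membership.index-injective ≅-setoid (cover _ (reach i)) (cover _ (reach j)) same)
    where
    reach : (i : Fin N) → Reach opts p (g (toℕ i))
    reach i = reach₀ ◅◅ chain-reach chain z≤n (toℕ<n i)
    position : Fin N → Fin (length xs)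
    position i = Any.index (cover _ (reach i))

module ShiftGame (opts : Options)
  (moves-shift : ∀ {μ q} → Move opts μ q → q ≡ shift 1 0 μ ⊎ q ≡ shift 0 1 μ)
  ([]-terminal : ∀ {q} → ¬ Move opts [] q)
  (branching-≤2 : ∀ μ → length (opts μ) ≤ 2)
  (row-move : ∀ {μ} → 1 < length μ → Move opts μ (shift 1 0 μ))
  (column-move : ∀ {m r} → 1 < m → Move opts (m ∷ r) (dropColumns 1 (m ∷ r))) where

  open Chains opts

  size-< : ∀ {μ q} → Move opts μ q → size q < size μ
  size-< {[]} mv = contradiction mv []-terminal
  size-< {m ∷ r} mv = size-shift-< m r (moves-shift mv)

  open RankedGame opts size size-< branching-≤2 public

  move-positive : ∀ {μ q} → Move opts μ q → Positive q
  move-positive {μ} mv with moves-shift mv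
  ... | inj₁ refl = shift-positive 1 0 μ
  ... | inj₂ refl = shift-positive 0 1 μ

  Subdiagram : List ℕ → List ℕ → Set
  Subdiagram λ′ q = ∃₂ λ i j → q ≡ dropColumns j (drop i λ′)

  subdiagram-move : ∀ {λ′ p q} → Descending λ′ → Subdiagram λ′ p → Move opts p q → Subdiagram λ′ q
  subdiagram-move {λ′} desc (i , j , refl) mv with moves-shift mv
  ... | inj₁ refl = i + 1 , j , (begin
    shift 1 0 (dropColumns j ν)     ≡⟨ shift-1-0 (dropColumns-positive j ν) (dropColumns-descending j desc-ν) ⟩
    drop 1 (dropColumns j ν)        ≡⟨ drop-dropColumns j desc-ν ⟩
    dropColumns j (drop 1 ν)        ≡⟨ cong (dropColumns j) (drop-drop i 1 λ′) ⟩
    dropColumns j (drop (i + 1) λ′) ∎)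
    where
    open ≡-Reasoning
    ν : List ℕ
    ν = drop i λ′
    desc-ν : Descending ν
    desc-ν = AllPairs.drop⁺ i desc
  ... | inj₂ refl = i , j + 1 ,
    trans (shift-descending 0 1 (dropColumns-descending j (AllPairs.drop⁺ i desc)))
          (dropColumns-+ 1 j (drop i λ′))

  reachable-subdiagram : ∀ {λ′ q} → Positive λ′ → Descending λ′ → Reach opts λ′ q → Subdiagram λ′ q
  reachable-subdiagram {λ′} pos desc = go (0 , 0 , sym (dropColumns-zero pos))
    where
    go : ∀ {p q} → Subdiagram λ′ p → Reach opts p q → Subdiagram λ′ q
    go sub ε = sub
    go sub (mv ◅ r) = go (subdiagram-move desc sub mv) r

  reachable-cell : ∀ {λ′ q} → Positive λ′ → Descending λ′ → Reach opts λ′ q → q ≡ [] ⊎ q ∈ cells λ′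
  reachable-cell pos desc r with reachable-subdiagram pos desc r
  ... | i , j , refl = subdiagram-cell i j desc

  row-chain : ∀ {μ} → Positive μ → Descending μ → Chain (λ i → drop i μ) (length μ)
  row-chain {μ} pos desc i 2+i≤|μ| = subst (Move opts (drop i μ)) drop-suc (row-move 1<|drop|)
    where
    drop-suc : shift 1 0 (drop i μ) ≡ drop (suc i) μ
    drop-suc = trans (shift-1-0 (All.drop⁺ i pos) (AllPairs.drop⁺ i desc))
                     (trans (drop-drop i 1 μ) (cong (λ n → drop n μ) (+-comm i 1)))
    1<|drop| : 1 < length (drop i μ)
    1<|drop| = subst (1 <_) (sym (length-drop i μ)) (m+n≤o⇒m≤o∸n 2 2+i≤|μ|)

  column-chain : ∀ m r → Chain (λ j → dropColumns j (m ∷ r)) m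
  column-chain m r j 2+j≤m = subst₂ (Move opts) (sym first-row) next (column-move 1<m∸j)
    where
    1<m∸j : 1 < m ∸ j
    1<m∸j = m+n≤o⇒m≤o∸n 2 2+j≤m
    first-row : dropColumns j (m ∷ r) ≡ m ∸ j ∷ dropColumns j r
    first-row = dropColumns-accept j m r (<-trans z<s 1<m∸j)
    next : dropColumns 1 (m ∸ j ∷ dropColumns j r) ≡ dropColumns (suc j) (m ∷ r)
    next = begin
      dropColumns 1 (m ∸ j ∷ dropColumns j r) ≡⟨ cong (dropColumns 1) first-row ⟨
      dropColumns 1 (dropColumns j (m ∷ r))   ≡⟨ dropColumns-+ 1 j (m ∷ r) ⟩
      dropColumns (j + 1) (m ∷ r)             ≡⟨ cong (λ n → dropColumns n (m ∷ r)) (+-comm j 1) ⟩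
      dropColumns (suc j) (m ∷ r)             ∎
      where open ≡-Reasoning

  columns-reachable : ∀ {p m r} → Positive (m ∷ r) → Reach opts p (m ∷ r) →
                      All (Reach opts p) (applyUpTo (λ j → dropColumns j (m ∷ r)) m)
  columns-reachable {m = m} {r} pos reach = All.applyUpTo⁺₁ _ m λ {j} j<m →
    reach ◅◅ subst (λ μ → Reach opts μ (dropColumns j (m ∷ r))) (dropColumns-zero pos)
                   (chain-reach (column-chain m r) z≤n j<m)

  cells-reachable : ∀ {p μ} → Positive μ → Descending μ → Reach opts p μ → All (Reach opts p) (cells μ)
  cells-reachable {μ = []} _ _ _ = []
  cells-reachable {μ = _ ∷ []} pos _ reach = All.++⁺ (columns-reachable pos reach) []
  cells-reachable {μ = _ ∷ _ ∷ _} pos@(_ ∷ pos′) desc@(_ ∷ desc′) reach =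
    All.++⁺ (columns-reachable pos reach)
            (cells-reachable pos′ desc′ (reach ◅◅ (row-chain pos desc 0 (s≤s (s≤s z≤n)) ◅ ε)))

  square-bound : ∀ {λ′ n k} → λ′ ⊢ n → 1 ≤ n → NumStates opts λ′ k → n ≤ k * k
  square-bound {[]} (_ , refl) ()
  square-bound {m ∷ r} {k = k} ((pos , linked) , refl) _ ns = begin
    sum (m ∷ r)            ≤⟨ sum-≤-length*head desc ⟩
    length (m ∷ r) * m     ≤⟨ *-mono-≤ (chain-length-≤ (row-chain pos desc) ε ns)
                                        (chain-length-≤ (column-chain m r) reach₀ ns) ⟩
    k * k                  ∎
    where
    open ≤-Reasoning
    desc : Descending (m ∷ r)
    desc = partition-descending linked
    reach₀ : Reach opts (m ∷ r) (dropColumns 0 (m ∷ r))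
    reach₀ = subst (Reach opts (m ∷ r)) (sym (dropColumns-zero pos)) ε

lctr-moves : ∀ {μ q} → Move lctr μ q → q ≡ shift 1 0 μ ⊎ q ≡ shift 0 1 μ
lctr-moves {_ ∷ _} (here q≡) = inj₁ q≡
lctr-moves {_ ∷ _} (there (here q≡)) = inj₂ q≡

lctr-row-move : ∀ {μ} → 1 < length μ → Move lctr μ (shift 1 0 μ)
lctr-row-move {_ ∷ _} _ = here refl

lctr-column-move : ∀ {m r} → 1 < m → Move lctr (m ∷ r) (dropColumns 1 (m ∷ r))
lctr-column-move {suc zero} (s≤s ())
lctr-column-move {suc (suc _)} _ = there (here refl)

lctr-branching : ∀ μ → length (lctr μ) ≤ 2
lctr-branching [] = z≤n
lctr-branching (_ ∷ _) = ≤-refl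

downright-moves : ∀ {μ q} → Move downright μ q → q ≡ shift 1 0 μ ⊎ q ≡ shift 0 1 μ
downright-moves {suc (suc _) ∷ []} (here q≡) = inj₂ q≡
downright-moves {_ ∷ _ ∷ _} (here q≡) = inj₁ q≡
downright-moves {suc (suc _) ∷ _ ∷ _} (there (here q≡)) = inj₂ q≡

downright-row-move : ∀ {μ} → 1 < length μ → Move downright μ (shift 1 0 μ)
downright-row-move {_ ∷ []} (s≤s ())
downright-row-move {_ ∷ _ ∷ _} _ = here refl

downright-column-move : ∀ {m r} → 1 < m → Move downright (m ∷ r) (dropColumns 1 (m ∷ r))
downright-column-move {suc zero} (s≤s ())
downright-column-move {suc (suc _)} {[]} _ = here refl
downright-column-move {suc (suc _)} {_ ∷ _} _ = there (here refl)

downright-branching : ∀ μ → length (downright μ) ≤ 2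
downright-branching [] = z≤n
downright-branching (zero ∷ []) = z≤n
downright-branching (suc zero ∷ []) = z≤n
downright-branching (suc (suc _) ∷ []) = s≤s z≤n
downright-branching (zero ∷ _ ∷ _) = s≤s z≤n
downright-branching (suc zero ∷ _ ∷ _) = s≤s z≤n
downright-branching (suc (suc _) ∷ _ ∷ _) = ≤-refl

downright-nonempty : ∀ {μ q} → Positive μ → Move downright μ q → q ≢ []
downright-nonempty {suc (suc _) ∷ []} _ (here refl) ()
downright-nonempty {_ ∷ zero ∷ _} (_ ∷ () ∷ _)
downright-nonempty {_ ∷ suc _ ∷ _} _ (here refl) ()
downright-nonempty {suc (suc _) ∷ _ ∷ _} _ (there (here refl)) ()

module LCTR = ShiftGame lctr (λ {μ} → lctr-moves {μ}) (λ ()) lctr-branching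
  (λ {μ} → lctr-row-move {μ}) (λ {m} → lctr-column-move {m})
module Downright = ShiftGame downright (λ {μ} → downright-moves {μ}) (λ ()) downright-branching
  (λ {μ} → downright-row-move {μ}) (λ {m} {r} → downright-column-move {m} {r})

lctr-reach-[] : ∀ {μ} → Positive μ → Descending μ → Reach lctr μ []
lctr-reach-[] {[]} _ _ = ε
lctr-reach-[] {m ∷ r} pos@(_ ∷ pos′) desc@(_ ∷ desc′) =
  subst (Move lctr (m ∷ r)) (shift-1-0 pos desc) (here refl) ◅ lctr-reach-[] pos′ desc′

downright-reach-nonempty : ∀ {μ q} → Positive μ → μ ≢ [] → Reach downright μ q → q ≢ []
downright-reach-nonempty _ μ≢[] ε = μ≢[]
downright-reach-nonempty {μ} pos _ (mv ◅ r) =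
  downright-reach-nonempty (Downright.move-positive {μ} mv) (downright-nonempty pos mv) r

lctr-states-≤ : ∀ {n λ′} → λ′ ⊢ n → ∃ λ k → NumStates lctr λ′ k × k ≤ suc n
lctr-states-≤ {λ′ = λ′} ((pos , linked) , refl) =
  let k , ns , k≤ = LCTR.numStates-≤ ([] ∷ cells λ′)
                      (lctr-reach-[] pos desc ∷ LCTR.cells-reachable pos desc ε) complete
  in k , ns , subst (λ l → k ≤ suc l) (length-cells λ′) k≤
  where
  desc : Descending λ′
  desc = partition-descending linked
  complete : ∀ {q} → Reach lctr λ′ q → q ∈ [] ∷ cells λ′
  complete r = [ here , there ]′ (LCTR.reachable-cell pos desc r)

downright-states-≤ : ∀ {n λ′} → λ′ ⊢ n → λ′ ≢ [] → ∃ λ k → NumStates downright λ′ k × k ≤ n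
downright-states-≤ {λ′ = λ′} ((pos , linked) , refl) λ′≢[] =
  let k , ns , k≤ = Downright.numStates-≤ (cells λ′) (Downright.cells-reachable pos desc ε) complete
  in k , ns , subst (k ≤_) (length-cells λ′) k≤
  where
  desc : Descending λ′
  desc = partition-descending linked
  complete : ∀ {q} → Reach downright λ′ q → q ∈ cells λ′
  complete r with Downright.reachable-cell pos desc r
  ... | inj₁ q≡[] = contradiction q≡[] (downright-reach-nonempty pos λ′≢[] r)
  ... | inj₂ q∈cells = q∈cells

proposition6p10 : ((n : ℕ) (λ′ : List ℕ) → λ′ ⊢ n → ∃ λ k → NumStates lctr λ′ k × k ≤ suc n)
    × ((n : ℕ) (λ′ : List ℕ) → λ′ ⊢ n → λ′ ≢ [] → ∃ λ k → NumStates downright λ′ k × k ≤ n)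
    × (Σ ℕ λ a → Σ ℕ λ b → 0 < a × 0 < b ×
    ((n : ℕ) (λ′ : List ℕ) → 1 ≤ n → λ′ ⊢ n →
    (∀ k → NumStates lctr λ′ k → a * n ≤ b * (k * k))
    × (∀ k → NumStates downright λ′ k → a * n ≤ b * (k * k))))
proposition6p10 =
  (λ _ _ → lctr-states-≤) ,
  (λ _ _ → downright-states-≤) ,
  1 , 1 , z<s , z<s , λ n _ 1≤n λ′⊢n →
    (λ k → scaled n k ∘ LCTR.square-bound λ′⊢n 1≤n) ,
    (λ k → scaled n k ∘ Downright.square-bound λ′⊢n 1≤n)
  where
  scaled : ∀ n k → n ≤ k * k → 1 * n ≤ 1 * (k * k)
  scaled n k = subst₂ _≤_ (sym (*-identityˡ n)) (sym (*-identityˡ (k * k)))
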